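{- Let $G$ be a graph and $v\in V(G)$. Then $\rho_T(G)\le\rho_T(G-\{v\})+1$, where $G-\{v\}$ is the graph obtained from $G$ by deleting $v$ and all edges incident to $v$.
   Context: Graphs are finite and simple. The min-plus tropical semiring is $\mathbb{T}=(\mathbb{R}\cup\{\infty\},\min,+)$. For $u,v\in\mathbb{T}^k$, $u\odot v=\min_{1\le i\le k}(u_i+v_i)$. A min-plus $k$-tropical dot product representation of $G=(V,E)$ is a map $f:V\to\mathbb{T}^k$ together with a threshold $t>0$ such that for all distinct $x,y\in V$, $xy\in E$ iff $f(x)\odot f(y)\ge t$. The min-plus tropical dot product dimension $\rho_T(G)$ is the minimum $k$ such that $G$ has a min-plus $k$-tropical dot product representation.
   Formalization: The tropical dot product representations defining $\rho_T$ take values in ℚ ∪ {∞}, with rational thresholds t, instead of ℝ ∪ {∞} and real thresholds. -}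

module Defs where

open import Data.Nat using (ℕ; zero; suc)
open import Data.Fin using (Fin; punchIn)
open import Data.Maybe using (Maybe; just; nothing)
open import Data.Rational using (ℚ; 0ℚ) renaming (_+_ to _+ℚ_; _⊓_ to _⊓ℚ_; _≤_ to _≤ℚ_; _<_ to _<ℚ_)
open import Data.Unit using (⊤)
open import Data.Product using (Σ; _×_; ∃)
open import Relation.Nullary using (¬_)
open import Relation.Binary.PropositionalEquality using (_≢_)
open import Function.Bundles using (_⇔_)

record Graph (n : ℕ) : Set₁ where
  field
    Adj     : Fin n → Fin n → Set
    sym     : ∀ {x y} → Adj x y → Adj y x
    irrefl  : ∀ {x} → ¬ Adj x x
open Graph public

deleteVertex : ∀ {n} → Graph (suc n) → Fin (suc n) → Graph n
deleteVertex G v = record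
  { Adj    = λ i j → Adj G (punchIn v i) (punchIn v j)
  ; sym    = sym G
  ; irrefl = irrefl G
  }

-- The min-plus tropical semiring: nothing represents ∞.
𝕋 : Set
𝕋 = Maybe ℚ

_⊕_ : 𝕋 → 𝕋 → 𝕋
nothing ⊕ b = b
just a ⊕ nothing = just a
just a ⊕ just b = just (a ⊓ℚ b)

_⊗_ : 𝕋 → 𝕋 → 𝕋
nothing ⊗ _ = nothing
just a ⊗ nothing = nothing
just a ⊗ just b = just (a +ℚ b)

_⊙_ : ∀ {k} → (Fin k → 𝕋) → (Fin k → 𝕋) → 𝕋
_⊙_ {zero}  u v = nothing
_⊙_ {suc k} u v = (u Fin.zero ⊗ v Fin.zero) ⊕ _⊙_ {k} (λ i → u (Fin.suc i)) (λ i → v (Fin.suc i))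

_≥T_ : 𝕋 → ℚ → Set
nothing ≥T t = ⊤
just a ≥T t = t ≤ℚ a

IsTropRep : ∀ {n} → Graph n → (k : ℕ) → (Fin n → (Fin k → 𝕋)) → ℚ → Set
IsTropRep {n} G k f t =
  (0ℚ <ℚ t) × (∀ (x y : Fin n) → x ≢ y → (Adj G x y ⇔ ((f x ⊙ f y) ≥T t)))

HasTropRep : ∀ {n} → Graph n → ℕ → Set
HasTropRep {n} G k = Σ (Fin n → (Fin k → 𝕋)) λ f → ∃ λ t → IsTropRep G k f t

-- ρ_T(G) = k : k is the minimum dimension admitting a representation.
IsTropDim : ∀ {n} → Graph n → ℕ → Set
IsTropDim G k = HasTropRep G k × (∀ j → HasTropRep G j → k Data.Nat.≤ j)

{-# OPTIONS --safe #-}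

-- Given a representation f of G - v with threshold t, build F on G by prepending one
-- coordinate to f: v gets (-t, ∞, …, ∞), and every other vertex w gets ∞ if w ~ v and
-- t otherwise.  Then F(v) ⊙ F(w) is -t + ∞ = ∞ ≥ t or -t + t = 0 < t, exactly as adjacency to v demands,
-- while for w, w' ≠ v the new coordinate contributes at least 2t ≥ t and so does not
-- change whether the minimum reaches t.  Adjacency to v is decidable because G itself
-- has a representation.
module Submission where

open import Defs
open import Data.Nat using (ℕ; suc; _≤_)
open import Data.Fin using (Fin; punchIn; punchOut; _≟_)
open import Data.Fin.Properties using (punchIn-punchOut; punchInᵢ≢i)
open import Data.Maybe using (just; nothing)
open import Data.Rational using (ℚ; 0ℚ; -_) renaming (_+_ to _+ℚ_; _≤_ to _≤ℚ_; _<_ to _<ℚ_)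
import Data.Rational.Properties as ℚ
open import Data.Vec.Functional using (_∷_; replicate; insertAt)
open import Data.Vec.Functional.Properties using (insertAt-lookup; insertAt-punchIn)
open import Data.Unit using (tt)
open import Data.Product using (_×_; _,_; proj₁; proj₂)
open import Function using (_∘_; const)
open import Function.Bundles using (_⇔_; mk⇔)
import Function.Properties.Equivalence as ⇔
open import Relation.Nullary using (¬_; Dec; yes; no; contradiction)
import Relation.Nullary.Decidable as Dec
open import Relation.Binary.PropositionalEquality
  using (_≡_; _≢_; refl; cong; cong₂; subst; module ≡-Reasoning)
  renaming (sym to ≡-sym)

∞ : 𝕋
∞ = nothing

⊗-comm : ∀ a b → a ⊗ b ≡ b ⊗ a
⊗-comm nothing  nothing  = refl
⊗-comm nothing  (just _) = refl
⊗-comm (just _) nothing  = refl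
⊗-comm (just a) (just b) = cong just (ℚ.+-comm a b)

⊕-identityʳ : ∀ a → a ⊕ ∞ ≡ a
⊕-identityʳ nothing  = refl
⊕-identityʳ (just _) = refl

⊙-comm : ∀ {k} (u w : Fin k → 𝕋) → u ⊙ w ≡ w ⊙ u
⊙-comm {0}     u w = refl
⊙-comm {suc k} u w = cong₂ _⊕_ (⊗-comm (u Fin.zero) (w Fin.zero)) (⊙-comm {k} _ _)

⊙-zeroˡ : ∀ {k} (u : Fin k → 𝕋) → replicate k ∞ ⊙ u ≡ ∞
⊙-zeroˡ {0}     u = refl
⊙-zeroˡ {suc k} u = ⊙-zeroˡ {k} _

≥T-dec : ∀ a t → Dec (a ≥T t)
≥T-dec nothing  t = yes tt
≥T-dec (just a) t = t ℚ.≤? a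

⊕-≥T : ∀ a b {t} → (a ⊕ b) ≥T t ⇔ (a ≥T t × b ≥T t)
⊕-≥T nothing  b        = mk⇔ (tt ,_) proj₂
⊕-≥T (just a) nothing  = mk⇔ (_, tt) proj₁
⊕-≥T (just a) (just b) =
  mk⇔ (λ t≤a⊓b → ℚ.≤-trans t≤a⊓b (ℚ.p⊓q≤p a b) , ℚ.≤-trans t≤a⊓b (ℚ.p⊓q≤q a b))
      (λ (t≤a , t≤b) → ℚ.⊓-glb t≤a t≤b)

HasTropRep⇒Adj-dec : ∀ {n k} (G : Graph n) → HasTropRep G k →
                     ∀ {x y} → x ≢ y → Dec (Adj G x y)
HasTropRep⇒Adj-dec G (f , t , _ , rep) {x} {y} x≢y =
  Dec.map (⇔.sym (rep x y x≢y)) (≥T-dec (f x ⊙ f y) t)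

mark : {P : Set} → ℚ → Dec P → 𝕋
mark t (yes _) = ∞
mark t (no _)  = just t

-t⊗mark-≥T : ∀ {P : Set} {t} (d : Dec P) → 0ℚ <ℚ t → (just (- t) ⊗ mark t d) ≥T t ⇔ P
-t⊗mark-≥T (yes p) _ = mk⇔ (const p) (const tt)
-t⊗mark-≥T {t = t} (no ¬p) 0<t = mk⇔ (λ t≤-t+t → contradiction (t≤0 t≤-t+t) t≰0) (λ p → contradiction p ¬p)
  where
  t≤0 : t ≤ℚ (- t) +ℚ t → t ≤ℚ 0ℚ
  t≤0 = subst (t ≤ℚ_) (ℚ.+-inverseˡ t)
  t≰0 : ¬ t ≤ℚ 0ℚ
  t≰0 t≤0 = ℚ.<-irrefl refl (ℚ.<-≤-trans 0<t t≤0)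

mark⊗mark-≥T : ∀ {P Q : Set} {t} (d : Dec P) (e : Dec Q) → 0ℚ ≤ℚ t → (mark t d ⊗ mark t e) ≥T t
mark⊗mark-≥T (yes _) _       _   = tt
mark⊗mark-≥T (no _)  (yes _) _   = tt
mark⊗mark-≥T {t = t} (no _) (no _) 0≤t =
  subst (_≤ℚ t +ℚ t) (ℚ.+-identityʳ t) (ℚ.+-monoʳ-≤ t 0≤t)

apex : ∀ {s} → ℚ → Fin (suc s) → 𝕋
apex {s} t = just (- t) ∷ replicate s ∞

apex-⊙-≥T : ∀ {s} {P : Set} {t} (d : Dec P) (u : Fin s → 𝕋) → 0ℚ <ℚ t →
            (apex t ⊙ (mark t d ∷ u)) ≥T t ⇔ P
apex-⊙-≥T {s} {t = t} d u 0<t =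
  subst (λ a → a ≥T t ⇔ _) (≡-sym apex⊙≡) (-t⊗mark-≥T d 0<t)
  where
  open ≡-Reasoning
  apex⊙≡ : apex t ⊙ (mark t d ∷ u) ≡ just (- t) ⊗ mark t d
  apex⊙≡ = begin
    (just (- t) ⊗ mark t d) ⊕ (replicate s ∞ ⊙ u) ≡⟨ cong (_ ⊕_) (⊙-zeroˡ u) ⟩
    (just (- t) ⊗ mark t d) ⊕ ∞                   ≡⟨ ⊕-identityʳ _ ⟩
    just (- t) ⊗ mark t d                          ∎

mark∷-⊙-≥T : ∀ {s} {P Q : Set} {t} (d : Dec P) (e : Dec Q) (u w : Fin s → 𝕋) → 0ℚ ≤ℚ t →
             ((mark t d ∷ u) ⊙ (mark t e ∷ w)) ≥T t ⇔ (u ⊙ w) ≥T t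
mark∷-⊙-≥T d e u w 0≤t =
  ⇔.trans (⊕-≥T _ (u ⊙ w)) (mk⇔ proj₂ (mark⊗mark-≥T d e 0≤t ,_))

data PunchView {n} (v : Fin (suc n)) : Fin (suc n) → Set where
  at      : PunchView v v
  punched : ∀ i → PunchView v (punchIn v i)

punchView : ∀ {n} (v w : Fin (suc n)) → PunchView v w
punchView v w with v ≟ w
... | yes refl = at
... | no v≢w   = subst (PunchView v) (punchIn-punchOut v≢w) (punched (punchOut v≢w))

module _ {n s : ℕ} (G : Graph (suc n)) (v : Fin (suc n))
         (adj? : ∀ i → Dec (Adj G v (punchIn v i))) where

  row : (Fin n → Fin s → 𝕋) → ℚ → Fin n → Fin (suc s) → 𝕋
  row f t i = mark t (adj? i) ∷ f i

  extend : (Fin n → Fin s → 𝕋) → ℚ → Fin (suc n) → Fin (suc s) → 𝕋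
  extend f t = insertAt (row f t) v (apex t)

  extend-IsTropRep : ∀ {f t} → IsTropRep (deleteVertex G v) s f t → IsTropRep G (suc s) (extend f t) t
  extend-IsTropRep {f} {t} (0<t , rep) = 0<t , adjacent⇔
    where
    F = extend f t

    v~punchIn⇔ : ∀ j → Adj G v (punchIn v j) ⇔ (F v ⊙ F (punchIn v j)) ≥T t
    v~punchIn⇔ j
      rewrite insertAt-lookup (row f t) v (apex t)
            | insertAt-punchIn (row f t) v (apex t) j
      = ⇔.sym (apex-⊙-≥T (adj? j) (f j) 0<t)

    punchIn~v⇔ : ∀ i → Adj G (punchIn v i) v ⇔ (F (punchIn v i) ⊙ F v) ≥T t
    punchIn~v⇔ i = subst (λ a → Adj G (punchIn v i) v ⇔ a ≥T t) (⊙-comm (F v) (F (punchIn v i)))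
                         (⇔.trans (mk⇔ (sym G) (sym G)) (v~punchIn⇔ i))

    punchIn~punchIn⇔ : ∀ i j → i ≢ j → Adj G (punchIn v i) (punchIn v j) ⇔ (F (punchIn v i) ⊙ F (punchIn v j)) ≥T t
    punchIn~punchIn⇔ i j i≢j
      rewrite insertAt-punchIn (row f t) v (apex t) i
            | insertAt-punchIn (row f t) v (apex t) j
      = ⇔.trans (rep i j i≢j) (⇔.sym (mark∷-⊙-≥T (adj? i) (adj? j) (f i) (f j) (ℚ.<⇒≤ 0<t)))

    adjacent⇔ : ∀ x y → x ≢ y → Adj G x y ⇔ (F x ⊙ F y) ≥T t
    adjacent⇔ x y x≢y with punchView v x | punchView v y
    ... | at        | at        = contradiction refl x≢y
    ... | at        | punched j = v~punchIn⇔ j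
    ... | punched i | at        = punchIn~v⇔ i
    ... | punched i | punched j = punchIn~punchIn⇔ i j (x≢y ∘ cong (punchIn v))

mainTheorem2 : ∀ {n} (G : Graph (suc n)) (v : Fin (suc n)) (r s : ℕ) →
    IsTropDim G r → IsTropDim (deleteVertex G v) s → r ≤ suc s
mainTheorem2 G v r s (repG , minimal) ((f , t , rep) , _) =
  minimal (suc s) (extend G v adj? f t , t , extend-IsTropRep G v adj? rep)
  where
  adj? : ∀ i → Dec (Adj G v (punchIn v i))
  adj? i = HasTropRep⇒Adj-dec G repG (punchInᵢ≢i v i ∘ ≡-sym)
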